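{- Let $a>3$ be an odd integer and let $N=4a^2+1$. Then neither $\frac{\sqrt{N}+1}{4}$ nor $\frac{\sqrt{N}-1}{4}$ is equivalent to $\sqrt{N}$.
   Context: Two irrational real numbers $x,y$ are called equivalent if $y=\frac{px+q}{rx+s}$ for some integers $p,q,r,s$ with $ps-qr=\pm1$; equivalently, their simple continued fraction expansions eventually coincide (for quadratic irrationals: their periodic parts are equal). -}

module Defs where

open import Data.Nat using (ℕ)
open import Data.Integer using (ℤ; +_; -[1+_]; _+_; _*_; _-_; -_)
open import Data.Product using (Σ; _×_; _,_)
open import Data.Sum using (_⊎_)
open import Relation.Binary.PropositionalEquality using (_≡_; _≢_)
open import Relation.Nullary using (¬_)

-- Elements of ℤ[√N]: a pair (u , v) stands for u + v√N.
ZN : Set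
ZN = ℤ × ℤ

zeroZN : ZN
zeroZN = (+ 0 , + 0)

_⊕_ : ZN → ZN → ZN
(a , b) ⊕ (c , d) = (a + c , b + d)

mulZN : ℕ → ZN → ZN → ZN
mulZN N (a , b) (c , d) = (a * c + (+ N) * (b * d) , a * d + b * c)

_·_ : ℤ → ZN → ZN
k · (a , b) = (k * a , k * b)

-- Elements of ℚ(√N) written as a fraction (u + v√N) / d, d a (nonzero) integer.
QN : Set
QN = ZN × ℤ

-- x and y are equivalent: y = (p x + q) / (r x + s) with p s - q r = ±1
-- (and r x + s ≠ 0).  With x = nx/dx and y = ny/dy this is, after clearing
-- denominators:  ny (r nx + s dx) = dy (p nx + q dx)  in ℤ[√N].
-- Since N is not a perfect square in our application, equality of pairs in
-- ℤ[√N] is exactly equality of the corresponding real numbers.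
Equivalent : ℕ → QN → QN → Set
Equivalent N (nx , dx) (ny , dy) =
  Σ ℤ λ p → Σ ℤ λ q → Σ ℤ λ r → Σ ℤ λ s →
    ((p * s - q * r ≡ + 1) ⊎ (p * s - q * r ≡ -[1+ 0 ])) ×
    ((r · nx) ⊕ (s · (dx , + 0)) ≢ zeroZN) ×
    (mulZN N ny ((r · nx) ⊕ (s · (dx , + 0)))
      ≡ mulZN N (dy , + 0) ((p · nx) ⊕ (q · (dx , + 0))))

sqrtN : QN
sqrtN = ((+ 0 , + 1) , + 1)

sqrtNplus1over4 : QN
sqrtNplus1over4 = ((+ 1 , + 1) , + 4)

sqrtNminus1over4 : QN
sqrtNminus1over4 = ((-[1+ 0 ] , + 1) , + 4)

-- Write N = (2A)² + 1, so that 2A + √N is a unit of norm −1 in ℤ[√N]. If an integer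
-- matrix (p q ; r s) of determinant ±1 maps √N to (ε + √N)/4 with ε = ±1, comparing
-- coordinates gives s + εr = 4p and εs + Nr = 4q, hence s² − Nr² = 4(ps − qr) = ±4, and
-- r, s are odd because ps − qr is. Multiplying s + r√N by the unit √N − 2A gives
-- s' + r'√N with r' = s − 2Ar and s' = r − 2Ar', whose norm has the same absolute value;
-- r' and s' are again odd, and either 0 < r' < r or a size estimate already shows
-- |s² − Nr²| > 4. The descent ends at r = 1, where no odd s has s² within 4 of
-- (2A)² + 1 as soon as A ≥ 2.
module Submission where

open import Defs

module NormDescent where
  open import Data.Nat using (ℕ; zero; suc; _+_; _*_; _≤_; _<_; _>_; ∣_-_∣; z≤n; s≤s; z<s)
  open import Data.Nat.Properties
  open import Data.Nat.Divisibility using (_∣_; _∤_; _∣0; ∣-refl; ∣m∣n⇒∣m+n; ∣m⇒∣m*n; m∣m*n)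
  open import Data.Nat.Induction using (<-rec)
  open import Data.Nat.Tactic.RingSolver using (solve-∀)
  open import Data.Product using (_,_; proj₂)
  open import Data.Sum using (inj₁; inj₂)
  open import Relation.Nullary using (contradiction)
  open import Relation.Binary.PropositionalEquality

  n≡m+o⇒4<∣m-n∣ : ∀ m {n o} → n ≡ m + o → 5 ≤ o → 4 < ∣ m - n ∣
  n≡m+o⇒4<∣m-n∣ m {o = o} refl 5≤o = subst (4 <_) (sym (∣m-m+n∣≡n m o)) 5≤o

  square-below-gap : ∀ {s x y} → s ≤ x → 5 ≤ y → 4 < ∣ s * s - (x * x + y) ∣
  square-below-gap {s} {x} {y} s≤x 5≤y with m≤n⇒∃[o]m+o≡n (*-mono-≤ s≤x s≤x)
  ... | o , s²+o≡x² = n≡m+o⇒4<∣m-n∣ (s * s) x²+y≡s²+[o+y] (≤-trans 5≤y (m≤n+m y o))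
    where
    x²+y≡s²+[o+y] : x * x + y ≡ s * s + (o + y)
    x²+y≡s²+[o+y] = trans (cong (_+ y) (sym s²+o≡x²)) (+-assoc (s * s) o y)

  square-above-gap : ∀ {s x M y} → x ≤ s → 5 ≤ y → M + y ≡ x * x → 4 < ∣ s * s - M ∣
  square-above-gap {s} {x} {M} {y} x≤s 5≤y M+y≡x² with m≤n⇒∃[o]m+o≡n (*-mono-≤ x≤s x≤s)
  ... | o , x²+o≡s² = subst (4 <_) (∣-∣-comm M (s * s)) (n≡m+o⇒4<∣m-n∣ M s²≡M+[y+o] (≤-trans 5≤y (m≤m+n y o)))
    where
    s²≡M+[y+o] : s * s ≡ M + (y + o)
    s²≡M+[y+o] = begin
      s * s        ≡⟨ x²+o≡s² ⟨
      x * x + o    ≡⟨ cong (_+ o) M+y≡x² ⟨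
      M + y + o    ≡⟨ +-assoc M y o ⟩
      M + (y + o)  ∎
      where open ≡-Reasoning

  m+n≡o+p⇒∣m-o∣≡∣p-n∣ : ∀ {m n o p} → m + n ≡ o + p → ∣ m - o ∣ ≡ ∣ p - n ∣
  m+n≡o+p⇒∣m-o∣≡∣p-n∣ {m} {n} {o} {p} m+n≡o+p = begin
    ∣ m - o ∣             ≡⟨ ∣m+n-m+o∣≡∣n-o∣ n m o ⟨
    ∣ n + m - n + o ∣     ≡⟨ cong₂ ∣_-_∣ (trans (+-comm n m) m+n≡o+p) (+-comm n o) ⟩
    ∣ o + p - o + n ∣     ≡⟨ ∣m+n-m+o∣≡∣n-o∣ o p n ⟩
    ∣ p - n ∣             ∎
    where open ≡-Reasoning

  2∤n⇒n>0 : ∀ {n} → 2 ∤ n → n > 0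
  2∤n⇒n>0 {zero}  2∤0 = contradiction (2 ∣0) 2∤0
  2∤n⇒n>0 {suc n} _   = z<s

  2∤2km+n⇒2∤n : ∀ k m {n} → 2 ∤ 2 * k * m + n → 2 ∤ n
  2∤2km+n⇒2∤n k m 2∤2km+n 2∣n = 2∤2km+n (∣m∣n⇒∣m+n (∣m⇒∣m*n m (m∣m*n k)) 2∣n)

  5≤[3+n]² : ∀ n → 5 ≤ (3 + n) * (3 + n)
  5≤[3+n]² n = ≤-trans (m≤m+n 5 4) (*-mono-≤ (m≤m+n 3 n) (m≤m+n 3 n))

  N : ℕ → ℕ
  N A = 4 * (A * A) + 1

  absNorm : ℕ → ℕ → ℕ → ℕ
  absNorm A s r = ∣ s * s - N A * (r * r) ∣

  N[2+a]≡[3+2a]²+[5+[3+4a]] : ∀ a → 4 * ((2 + a) * (2 + a)) + 1 ≡ (3 + 2 * a) * (3 + 2 * a) + (5 + (3 + 4 * a))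
  N[2+a]≡[3+2a]²+[5+[3+4a]] = solve-∀

  N[2+a]+[5+[3+4a]]≡[5+2a]² : ∀ a → 4 * ((2 + a) * (2 + a)) + 1 + (5 + (3 + 4 * a)) ≡ (5 + 2 * a) * (5 + 2 * a)
  N[2+a]+[5+[3+4a]]≡[5+2a]² = solve-∀

  4<absNorm[s,1] : ∀ {A} → 2 ≤ A → ∀ s → 2 ∤ s → 4 < absNorm A s 1
  4<absNorm[s,1] {A@(suc (suc a))} (s≤s (s≤s z≤n)) s 2∤s rewrite *-identityʳ (N A) with ≤-<-connex s (3 + 2 * a)
  ... | inj₁ s≤2A-1 = subst (λ n → 4 < ∣ s * s - n ∣) (sym (N[2+a]≡[3+2a]²+[5+[3+4a]] a)) (square-below-gap s≤2A-1 (m≤m+n 5 _))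
  ... | inj₂ 2A-1<s = square-above-gap 2A+1≤s (m≤m+n 5 _) (N[2+a]+[5+[3+4a]]≡[5+2a]² a)
    where
    2∣2A : 2 ∣ 4 + 2 * a
    2∣2A = subst (2 ∣_) (*-distribˡ-+ 2 2 a) (m∣m*n (2 + a))
    2A+1≤s : 5 + 2 * a ≤ s
    2A+1≤s = ≤∧≢⇒< 2A-1<s (λ 2A≡s → 2∤s (subst (2 ∣_) 2A≡s 2∣2A))

  N*r²≡[2Ar]²+r² : ∀ A r → (4 * (A * A) + 1) * (r * r) ≡ (2 * A * r) * (2 * A * r) + r * r
  N*r²≡[2Ar]²+r² = solve-∀

  4<absNorm-below : ∀ {A r s} → 5 ≤ r * r → s ≤ 2 * A * r → 4 < absNorm A s r
  4<absNorm-below {A} {r} {s} 5≤r² s≤2Ar =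
    subst (λ n → 4 < ∣ s * s - n ∣) (sym (N*r²≡[2Ar]²+r² A r)) (square-below-gap s≤2Ar 5≤r²)

  [2Ar+r']²+r²≡Nr²+2r[2Ar']+r'² : ∀ A r r' →
    (2 * A * r + r') * (2 * A * r + r') + r * r
      ≡ (4 * (A * A) + 1) * (r * r) + 2 * r * (2 * A * r') + r' * r'
  [2Ar+r']²+r²≡Nr²+2r[2Ar']+r'² = solve-∀

  m+2r[1+r+d]+k≡r²+[m+[r²+2r[1+d]+k]] : ∀ m r d k →
    m + 2 * r * (suc r + d) + k ≡ r * r + (m + (r * r + 2 * r * (1 + d) + k))
  m+2r[1+r+d]+k≡r²+[m+[r²+2r[1+d]+k]] = solve-∀

  4<absNorm-above : ∀ {A r r' d} → 5 ≤ r * r → suc r + d ≡ 2 * A * r' → 4 < absNorm A (2 * A * r + r') r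
  4<absNorm-above {A} {r} {r'} {d} 5≤r² 1+r+d≡2Ar' =
    subst (4 <_) (∣-∣-comm (N A * (r * r)) (s * s))
      (n≡m+o⇒4<∣m-n∣ (N A * (r * r)) s²≡Nr²+[r²+2r[1+d]+r'²] (≤-trans 5≤r² (≤-trans (m≤m+n (r * r) _) (m≤m+n _ _))))
    where
    s : ℕ
    s = 2 * A * r + r'
    s²≡Nr²+[r²+2r[1+d]+r'²] : s * s ≡ N A * (r * r) + (r * r + 2 * r * (1 + d) + r' * r')
    s²≡Nr²+[r²+2r[1+d]+r'²] = +-cancelʳ-≡ (r * r) _ _ (begin
      s * s + r * r                                          ≡⟨ [2Ar+r']²+r²≡Nr²+2r[2Ar']+r'² A r r' ⟩
      N A * (r * r) + 2 * r * (2 * A * r') + r' * r'         ≡⟨ cong (λ t → N A * (r * r) + 2 * r * t + r' * r') 1+r+d≡2Ar' ⟨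
      N A * (r * r) + 2 * r * (suc r + d) + r' * r'          ≡⟨ m+2r[1+r+d]+k≡r²+[m+[r²+2r[1+d]+k]] (N A * (r * r)) r d (r' * r') ⟩
      r * r + (N A * (r * r) + (r * r + 2 * r * (1 + d) + r' * r')) ≡⟨ +-comm (r * r) _ ⟩
      N A * (r * r) + (r * r + 2 * r * (1 + d) + r' * r') + r * r ∎)
      where open ≡-Reasoning

  s²+s'²≡Nr²+Nr'² : ∀ A r' s' →
    (2 * A * (2 * A * r' + s') + r') * (2 * A * (2 * A * r' + s') + r') + s' * s'
      ≡ (4 * (A * A) + 1) * ((2 * A * r' + s') * (2 * A * r' + s')) + (4 * (A * A) + 1) * (r' * r')
  s²+s'²≡Nr²+Nr'² = solve-∀

  absNorm-unit-step : ∀ A r' s' → absNorm A (2 * A * (2 * A * r' + s') + r') (2 * A * r' + s') ≡ absNorm A s' r'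
  absNorm-unit-step A r' s' = begin
    ∣ s * s - N A * (r * r) ∣      ≡⟨ m+n≡o+p⇒∣m-o∣≡∣p-n∣ {s * s} {s' * s'} (s²+s'²≡Nr²+Nr'² A r' s') ⟩
    ∣ N A * (r' * r') - s' * s' ∣  ≡⟨ ∣-∣-comm (N A * (r' * r')) (s' * s') ⟩
    ∣ s' * s' - N A * (r' * r') ∣  ∎
    where
    open ≡-Reasoning
    r s : ℕ
    r = 2 * A * r' + s'
    s = 2 * A * r + r'

  4<absNorm : ∀ {A} → 2 ≤ A → ∀ r s → 2 ∤ r → 2 ∤ s → 4 < absNorm A s r
  4<absNorm {A} 2≤A@(s≤s (s≤s _)) = <-rec P step
    where
    P : ℕ → Set
    P r = ∀ s → 2 ∤ r → 2 ∤ s → 4 < absNorm A s r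

    descend : ∀ {r} → 5 ≤ r * r → (∀ {r'} → r' < r → P r') → P r
    descend {r} 5≤r² rec s 2∤r 2∤s with ≤-total s (2 * A * r)
    ... | inj₁ s≤2Ar = 4<absNorm-below {A} {r} 5≤r² s≤2Ar
    ... | inj₂ 2Ar≤s with m≤n⇒∃[o]m+o≡n 2Ar≤s
    ...   | r' , refl with <-≤-connex r (2 * A * r')
    ...     | inj₁ r<2Ar' = 4<absNorm-above {A} {r} {r'} 5≤r² (proj₂ (m≤n⇒∃[o]m+o≡n r<2Ar'))
    ...     | inj₂ 2Ar'≤r with m≤n⇒∃[o]m+o≡n 2Ar'≤r
    ...       | s' , refl =
      subst (4 <_) (sym (absNorm-unit-step A r' s')) (rec r'<r s' 2∤r' 2∤s')
      where
      2∤s' : 2 ∤ s'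
      2∤s' = 2∤2km+n⇒2∤n A r' 2∤r
      2∤r' : 2 ∤ r'
      2∤r' = 2∤2km+n⇒2∤n A (2 * A * r' + s') 2∤s
      r'<r : r' < 2 * A * r' + s'
      r'<r = <-≤-trans (m<m+n r' (2∤n⇒n>0 2∤s')) (+-monoˡ-≤ s' (m≤n*m r' (2 * A)))

    step : ∀ r → (∀ {r'} → r' < r → P r') → P r
    step 0 _ _ 2∤0 _ = contradiction (2 ∣0) 2∤0
    step 1 _ s _ 2∤s = 4<absNorm[s,1] 2≤A s 2∤s
    step 2 _ _ 2∤2 _ = contradiction ∣-refl 2∤2
    step (suc (suc (suc n))) = descend (5≤[3+n]² n)

module Equivalence where
  open import Data.Nat as ℕ using (ℕ; _≤_)
  import Data.Nat.Properties as ℕ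
  import Data.Nat.Divisibility as ℕ
  open import Data.Integer using (ℤ; +_; -[1+_]; _+_; _*_; _-_; _⊖_; _◃_; ∣_∣; sign)
  open import Data.Integer.Properties
    using (*-cancelˡ-≡; abs-*; pos-*; +◃n≡+n; m-n≡m⊖n; ∣⊖∣-≤; ∣m⊖n∣≡∣n⊖m∣)
  open import Data.Integer.Divisibility.Signed
    using (_∣_; divides; ∣⇒∣ᵤ; ∣ᵤ⇒∣; ∣m∣n⇒∣m-n; ∣m+n∣m⇒∣n; ∣m+n∣n⇒∣m; ∣n⇒∣m*n; ∣m⇒∣m*n)
  open import Data.Integer.Tactic.RingSolver using (solve)
  open import Data.Sign.Properties using (s*s≡+)
  open import Data.List using (_∷_; [])
  open import Data.Product using (_×_; _,_; proj₁; proj₂)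
  open import Data.Sum using (_⊎_; inj₁; inj₂)
  open import Function using (_∘_)
  open import Relation.Nullary using (¬_)
  open import Relation.Binary.PropositionalEquality
  open NormDescent using (N; absNorm; 4<absNorm)

  IsUnit : ℤ → Set
  IsUnit x = x ≡ + 1 ⊎ x ≡ -[1+ 0 ]

  ∣unit∣≡1 : ∀ {x} → IsUnit x → ∣ x ∣ ≡ 1
  ∣unit∣≡1 (inj₁ refl) = refl
  ∣unit∣≡1 (inj₂ refl) = refl

  2∤unit : ∀ {x} → IsUnit x → ¬ (+ 2 ∣ x)
  2∤unit x±1 2∣x with ℕ.∣1⇒≡1 (subst (2 ℕ.∣_) (∣unit∣≡1 x±1) (∣⇒∣ᵤ 2∣x))
  ... | ()

  unit*[unit*i]≡i : ∀ {ε} → IsUnit ε → ∀ i → ε * (ε * i) ≡ i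
  unit*[unit*i]≡i (inj₁ refl) i = solve (i ∷ [])
  unit*[unit*i]≡i (inj₂ refl) i = solve (i ∷ [])

  i*i≡+∣i∣*∣i∣ : ∀ i → i * i ≡ + (∣ i ∣ ℕ.* ∣ i ∣)
  i*i≡+∣i∣*∣i∣ i = trans (cong (_◃ (∣ i ∣ ℕ.* ∣ i ∣)) (s*s≡+ (sign i))) (+◃n≡+n _)

  ∣m⊖n∣≡∣m-n∣ : ∀ m n → ∣ m ⊖ n ∣ ≡ ℕ.∣ m - n ∣
  ∣m⊖n∣≡∣m-n∣ m n with ℕ.≤-total m n
  ... | inj₁ m≤n = trans (∣⊖∣-≤ m≤n) (sym (ℕ.m≤n⇒∣m-n∣≡n∸m m≤n))
  ... | inj₂ n≤m = trans (∣m⊖n∣≡∣n⊖m∣ m n) (trans (∣⊖∣-≤ n≤m) (sym (ℕ.m≤n⇒∣n-m∣≡n∸m n≤m)))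

  ∣s²-Nr²∣≡absNorm : ∀ A r s → ∣ s * s - + N A * (r * r) ∣ ≡ absNorm A ∣ s ∣ ∣ r ∣
  ∣s²-Nr²∣≡absNorm A r s = begin
    ∣ s * s - + N A * (r * r) ∣ ≡⟨ cong₂ (λ x y → ∣ x - y ∣) (i*i≡+∣i∣*∣i∣ s) +N*r²≡+[N*∣r∣²] ⟩
    ∣ + ∣s∣² - + N*∣r∣² ∣       ≡⟨ cong ∣_∣ (m-n≡m⊖n ∣s∣² N*∣r∣²) ⟩
    ∣ ∣s∣² ⊖ N*∣r∣² ∣           ≡⟨ ∣m⊖n∣≡∣m-n∣ ∣s∣² N*∣r∣² ⟩
    absNorm A ∣ s ∣ ∣ r ∣       ∎
    where
    open ≡-Reasoning
    ∣s∣² N*∣r∣² : ℕ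
    ∣s∣² = ∣ s ∣ ℕ.* ∣ s ∣
    N*∣r∣² = N A ℕ.* (∣ r ∣ ℕ.* ∣ r ∣)
    +N*r²≡+[N*∣r∣²] : + N A * (r * r) ≡ + N*∣r∣²
    +N*r²≡+[N*∣r∣²] = trans (cong (+ N A *_) (i*i≡+∣i∣*∣i∣ r)) (sym (pos-* (N A) _))

  coordinates : ∀ n ε p q r s →
    mulZN n (ε , + 1) ((r · (+ 0 , + 1)) ⊕ (s · (+ 1 , + 0)))
      ≡ mulZN n (+ 4 , + 0) ((p · (+ 0 , + 1)) ⊕ (q · (+ 1 , + 0))) →
    s + ε * r ≡ + 4 * p × ε * s + + n * r ≡ + 4 * q
  coordinates n ε p q r s eq = second , first
    where
    open ≡-Reasoning
    second : s + ε * r ≡ + 4 * p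
    second = begin
      s + ε * r                                              ≡⟨ solve (ε ∷ r ∷ s ∷ []) ⟩
      ε * (r * + 1 + s * + 0) + + 1 * (r * + 0 + s * + 1)     ≡⟨ cong proj₂ eq ⟩
      + 4 * (p * + 1 + q * + 0) + + 0 * (p * + 0 + q * + 1)   ≡⟨ solve (p ∷ q ∷ []) ⟩
      + 4 * p                                                ∎
    first : ε * s + + n * r ≡ + 4 * q
    first = begin
      ε * s + + n * r                                              ≡⟨ solve (ε ∷ r ∷ s ∷ []) ⟩
      ε * (r * + 0 + s * + 1) + + n * (+ 1 * (r * + 1 + s * + 0))   ≡⟨ cong proj₁ eq ⟩
      + 4 * (p * + 0 + q * + 1) + + n * (+ 0 * (p * + 1 + q * + 0)) ≡⟨ q-coordinate (+ n) ⟩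
      + 4 * q                                                      ∎
      where
      q-coordinate : ∀ m → + 4 * (p * + 0 + q * + 1) + m * (+ 0 * (p * + 1 + q * + 0)) ≡ + 4 * q
      q-coordinate m = solve (m ∷ p ∷ q ∷ [])

  norm≡4*det : ∀ n ε p q r s → s + ε * r ≡ + 4 * p → ε * s + n * r ≡ + 4 * q →
    s * s - n * (r * r) ≡ + 4 * (p * s - q * r)
  norm≡4*det n ε p q r s s+εr≡4p εs+nr≡4q = *-cancelˡ-≡ (+ 4) _ _ (begin
    + 4 * (s * s - n * (r * r))                    ≡⟨ solve (n ∷ ε ∷ r ∷ s ∷ []) ⟩
    + 4 * s * (s + ε * r) - + 4 * r * (ε * s + n * r) ≡⟨ cong₂ (λ x y → + 4 * s * x - + 4 * r * y) s+εr≡4p εs+nr≡4q ⟩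
    + 4 * s * (+ 4 * p) - + 4 * r * (+ 4 * q)       ≡⟨ solve (p ∷ q ∷ r ∷ s ∷ []) ⟩
    + 4 * (+ 4 * (p * s - q * r))                  ∎)
    where open ≡-Reasoning

  sqrtN≁[ε+√N]/4 : ∀ {A} → 2 ≤ A → ∀ {ε} → IsUnit ε → ¬ Equivalent (N A) sqrtN ((ε , + 1) , + 4)
  sqrtN≁[ε+√N]/4 {A} 2≤A {ε} ε±1 (p , q , r , s , det±1 , _ , eq) =
    ℕ.<-irrefl (sym absNorm≡4) (4<absNorm 2≤A ∣ r ∣ ∣ s ∣ (2∤r ∘ ∣ᵤ⇒∣) (2∤s ∘ ∣ᵤ⇒∣))
    where
    s+εr≡4p : s + ε * r ≡ + 4 * p
    s+εr≡4p = proj₁ (coordinates (N A) ε p q r s eq)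

    εs+Nr≡4q : ε * s + + N A * r ≡ + 4 * q
    εs+Nr≡4q = proj₂ (coordinates (N A) ε p q r s eq)

    absNorm≡4 : absNorm A ∣ s ∣ ∣ r ∣ ≡ 4
    absNorm≡4 = begin
      absNorm A ∣ s ∣ ∣ r ∣          ≡⟨ ∣s²-Nr²∣≡absNorm A r s ⟨
      ∣ s * s - + N A * (r * r) ∣    ≡⟨ cong ∣_∣ (norm≡4*det (+ N A) ε p q r s s+εr≡4p εs+Nr≡4q) ⟩
      ∣ + 4 * (p * s - q * r) ∣      ≡⟨ abs-* (+ 4) (p * s - q * r) ⟩
      4 ℕ.* ∣ p * s - q * r ∣        ≡⟨ cong (4 ℕ.*_) (∣unit∣≡1 det±1) ⟩
      4                              ∎
      where open ≡-Reasoning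

    2∣s+εr : + 2 ∣ s + ε * r
    2∣s+εr = subst (+ 2 ∣_) (sym s+εr≡4p) (∣m⇒∣m*n p (divides (+ 2) refl))

    2∣r⇒2∣s : + 2 ∣ r → + 2 ∣ s
    2∣r⇒2∣s 2∣r = ∣m+n∣n⇒∣m 2∣s+εr (∣n⇒∣m*n ε 2∣r)

    2∣s⇒2∣r : + 2 ∣ s → + 2 ∣ r
    2∣s⇒2∣r 2∣s = subst (+ 2 ∣_) (unit*[unit*i]≡i ε±1 r) (∣n⇒∣m*n ε (∣m+n∣m⇒∣n 2∣s+εr 2∣s))

    2∤r : ¬ (+ 2 ∣ r)
    2∤r 2∣r = 2∤unit det±1 (∣m∣n⇒∣m-n (∣n⇒∣m*n p (2∣r⇒2∣s 2∣r)) (∣n⇒∣m*n q 2∣r))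

    2∤s : ¬ (+ 2 ∣ s)
    2∤s = 2∤r ∘ 2∣s⇒2∣r

open import Data.Nat using (ℕ; _≤_; _<_; _*_; _+_; _%_)
open import Data.Nat.Properties using (≤-trans; m≤m+n)
open import Data.Product using (_×_; _,_)
open import Data.Sum using (inj₁; inj₂)
open import Relation.Binary.PropositionalEquality using (_≡_; refl)
open import Relation.Nullary using (¬_)
open Equivalence using (sqrtN≁[ε+√N]/4)

mainTheorem3 : (a : ℕ) → 3 < a → a % 2 ≡ 1 →
    ¬ Equivalent (4 * (a * a) + 1) sqrtN sqrtNplus1over4
    × ¬ Equivalent (4 * (a * a) + 1) sqrtN sqrtNminus1over4
mainTheorem3 a 3<a _ = sqrtN≁[ε+√N]/4 2≤a (inj₁ refl) , sqrtN≁[ε+√N]/4 2≤a (inj₂ refl)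
  where
  2≤a : 2 ≤ a
  2≤a = ≤-trans (m≤m+n 2 2) 3<a
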